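{- Let $\Gamma$ be a connected bipartite graph with bipartition $\{U,W\}$. (a) If $\Gamma$ admits an automorphism swapping $U$ and $W$, then $|\mathrm{Aut}(\Gamma\times K_2)|=4|\mathrm{TFA}(\Gamma)|$. (b) If $\Gamma$ admits no automorphism swapping $U$ and $W$, then $\mathrm{Aut}(\Gamma\times K_2)\cong\mathrm{TFA}(\Gamma)\rtimes Z_2$. In particular, in this case, $\Gamma$ is unstable if and only if it admits a non-diagonal TF-automorphism.
   Context: All graphs are finite, undirected, without multiple edges, but possibly with loops; $A(\Gamma)$ is the set of arcs (ordered pairs of adjacent vertices). The direct product $\Gamma\times\Sigma$ has vertex set $V(\Gamma)\times V(\Sigma)$, with $(u,i)\sim(v,j)$ iff $u\sim v$ in $\Gamma$ and $i\sim j$ in $\Sigma$. A graph $\Gamma$ is stable if $\mathrm{Aut}(\Gamma\times K_2)=\mathrm{Aut}(\Gamma)\times\mathrm{Aut}(K_2)$ (componentwise action), and unstable otherwise. A two-fold automorphism (TF-automorphism) of $\Gamma$ is a pair $(\alpha,\beta)$ of permutations of $V(\Gamma)$ such that for all $s,t\in V(\Gamma)$, $(s,t)\in A(\Gamma)\iff(s^\alpha,t^\beta)\in A(\Gamma)$. The TF-automorphisms form a group $\mathrm{TFA}(\Gamma)$ under $(\alpha_1,\beta_1)(\alpha_2,\beta_2)=(\alpha_1\alpha_2,\beta_1\beta_2)$. A TF-automorphism $(\alpha,\beta)$ is diagonal if $\alpha=\beta$. $Z_2$ is the cyclic group of order $2$. -}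

module Defs where

open import Data.Nat using (ℕ)
open import Data.Fin using (Fin)
open import Data.Bool using (Bool; true; false; not; _∧_; _xor_; T; if_then_else_)
open import Data.Product using (Σ; ∃; ∃-syntax; _×_; _,_; proj₁; proj₂)
open import Relation.Nullary using (¬_)
open import Relation.Binary.PropositionalEquality as ≡
  using (_≡_; refl; sym; trans; cong; cong₂)
open import Relation.Binary.Structures using (IsEquivalence)
open import Algebra.Bundles using (Group)
open import Function.Bundles using (Bijection)

-- Graphs: finite vertex type V, symmetric (Boolean) adjacency; loops allowed.
-- The arc set A(Γ) is { (u , v) | T (adj u v) }.

record Graph (V : Set) : Set where
  field
    adj     : V → V → Bool
    adj-sym : ∀ u v → adj u v ≡ adj v u
open Graph public

Arc : ∀ {V} → Graph V → V → V → Set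
Arc Γ u v = T (adj Γ u v)

_×ᴳ_ : ∀ {V W} → Graph V → Graph W → Graph (V × W)
adj     (Γ ×ᴳ Δ) (u , i) (v , j) = adj Γ u v ∧ adj Δ i j
adj-sym (Γ ×ᴳ Δ) (u , i) (v , j) = cong₂ _∧_ (adj-sym Γ u v) (adj-sym Δ i j)

K₂ : Graph Bool
adj K₂ a b = a xor b
adj-sym K₂ false false = refl
adj-sym K₂ false true  = refl
adj-sym K₂ true  false = refl
adj-sym K₂ true  true  = refl

data Walk {V} (Γ : Graph V) : V → V → Set where
  here : ∀ {u} → Walk Γ u u
  step : ∀ {u w v} → Arc Γ u w → Walk Γ w v → Walk Γ u v

Connected : ∀ {V} → Graph V → Set
Connected {V} Γ = V × (∀ u v → Walk Γ u v)

-- {U , W} given by side : V → Bool (U = side⁻¹ false, W = side⁻¹ true)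
-- is a bipartition: every arc joins U and W.
IsBipartition : ∀ {V} → Graph V → (V → Bool) → Set
IsBipartition Γ side = ∀ u v → Arc Γ u v → ¬ (side u ≡ side v)

-- Permutations (right-action convention: p ⨾ q = "first p, then q",
-- matching the paper's product α₁α₂ with exponential notation s^α).

record Perm (A : Set) : Set where
  field
    to      : A → A
    from    : A → A
    to-from : ∀ x → to (from x) ≡ x
    from-to : ∀ x → from (to x) ≡ x
open Perm public

_≈ₚ_ : ∀ {A} → Perm A → Perm A → Set
p ≈ₚ q = ∀ x → to p x ≡ to q x

idₚ : ∀ {A} → Perm A
idₚ = record { to = λ x → x ; from = λ x → x ; to-from = λ _ → refl ; from-to = λ _ → refl }

_⨾_ : ∀ {A} → Perm A → Perm A → Perm A
p ⨾ q = record
  { to = λ x → to q (to p x)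
  ; from = λ x → from p (from q x)
  ; to-from = λ x → trans (cong (to q) (to-from p (from q x))) (to-from q x)
  ; from-to = λ x → trans (cong (from p) (from-to q (to p x))) (from-to p x)
  }

invₚ : ∀ {A} → Perm A → Perm A
invₚ p = record { to = from p ; from = to p ; to-from = from-to p ; from-to = to-from p }

≈ₚ-equiv : ∀ {A} → IsEquivalence (_≈ₚ_ {A})
≈ₚ-equiv = record
  { refl = λ _ → refl
  ; sym = λ e x → sym (e x)
  ; trans = λ e f x → trans (e x) (f x) }

⨾-cong : ∀ {A} {p p' q q' : Perm A} → p ≈ₚ p' → q ≈ₚ q' → (p ⨾ q) ≈ₚ (p' ⨾ q')
⨾-cong {q = q} e f x = trans (cong (to q) (e x)) (f _)

inv-cong : ∀ {A} {p p' : Perm A} → p ≈ₚ p' → invₚ p ≈ₚ invₚ p'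
inv-cong {p = p} {p'} e x =
  trans (sym (from-to p' (from p x)))
        (trans (cong (from p') (sym (e (from p x)))) (cong (from p') (to-from p x)))

IsTF : ∀ {V} → Graph V → Perm V → Perm V → Set
IsTF Γ α β = ∀ s t → adj Γ s t ≡ adj Γ (to α s) (to β t)

IsAut : ∀ {V} → Graph V → Perm V → Set
IsAut Γ σ = ∀ u v → adj Γ u v ≡ adj Γ (to σ u) (to σ v)

record TFAut {V} (Γ : Graph V) : Set where
  constructor tf
  field
    α    : Perm V
    β    : Perm V
    isTF : IsTF Γ α β
open TFAut public

record Automorphism {V} (Γ : Graph V) : Set where
  constructor aut
  field
    σ     : Perm V
    isAut : IsAut Γ σ
open Automorphism public

module _ {V} (Γ : Graph V) where

  tf-comp : ∀ {α₁ β₁ α₂ β₂} → IsTF Γ α₁ β₁ → IsTF Γ α₂ β₂ → IsTF Γ (α₁ ⨾ α₂) (β₁ ⨾ β₂)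
  tf-comp {α₁} {β₁} h₁ h₂ s t = trans (h₁ s t) (h₂ (to α₁ s) (to β₁ t))

  tf-inv : ∀ {α β} → IsTF Γ α β → IsTF Γ (invₚ α) (invₚ β)
  tf-inv {α} {β} h s t =
    sym (trans (h (from α s) (from β t)) (cong₂ (adj Γ) (to-from α s) (to-from β t)))

  tf-id : IsTF Γ idₚ idₚ
  tf-id _ _ = refl

  tf-swap : ∀ {α β} → IsTF Γ α β → IsTF Γ β α
  tf-swap {α} {β} h s t = trans (adj-sym Γ s t) (trans (h t s) (adj-sym Γ (to α t) (to β s)))

  AutGroup : Group _ _
  AutGroup = record
    { Carrier = Automorphism Γ
    ; _≈_ = λ a b → σ a ≈ₚ σ b
    ; _∙_ = λ a b → aut (σ a ⨾ σ b) (tf-comp {σ a} {σ a} {σ b} {σ b} (isAut a) (isAut b))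
    ; ε = aut idₚ tf-id
    ; _⁻¹ = λ a → aut (invₚ (σ a)) (tf-inv {σ a} {σ a} (isAut a))
    ; isGroup = record
      { isMonoid = record
        { isSemigroup = record
          { isMagma = record
            { isEquivalence = record
              { refl = λ _ → refl ; sym = λ e x → sym (e x) ; trans = λ e f x → trans (e x) (f x) }
            ; ∙-cong = λ {a} {a'} {b} {b'} e f → ⨾-cong {p = σ a} {σ a'} {σ b} {σ b'} e f }
          ; assoc = λ _ _ _ _ → refl }
        ; identity = (λ _ _ → refl) , (λ _ _ → refl) }
      ; inverse = (λ a x → to-from (σ a) x) , (λ a x → from-to (σ a) x)
      ; ⁻¹-cong = λ {a} {b} e → inv-cong {p = σ a} {σ b} e } }

  _·ᵗ_ : TFAut Γ → TFAut Γ → TFAut Γ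
  a ·ᵗ b = tf (α a ⨾ α b) (β a ⨾ β b) (tf-comp {α a} {β a} {α b} {β b} (isTF a) (isTF b))

  _⁻¹ᵗ : TFAut Γ → TFAut Γ
  a ⁻¹ᵗ = tf (invₚ (α a)) (invₚ (β a)) (tf-inv {α a} {β a} (isTF a))

  εᵗ : TFAut Γ
  εᵗ = tf idₚ idₚ tf-id

  _≈ᵗ_ : TFAut Γ → TFAut Γ → Set
  a ≈ᵗ b = (α a ≈ₚ α b) × (β a ≈ₚ β b)

  TFAGroup : Group _ _
  TFAGroup = record
    { Carrier = TFAut Γ
    ; _≈_ = _≈ᵗ_
    ; _∙_ = _·ᵗ_
    ; ε = εᵗ
    ; _⁻¹ = _⁻¹ᵗ
    ; isGroup = record
      { isMonoid = record
        { isSemigroup = record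
          { isMagma = record
            { isEquivalence = record
              { refl = (λ _ → refl) , (λ _ → refl)
              ; sym = λ (e , f) → (λ x → sym (e x)) , (λ x → sym (f x))
              ; trans = λ (e , f) (e' , f') → (λ x → trans (e x) (e' x)) , (λ x → trans (f x) (f' x)) }
            ; ∙-cong = λ {a} {a'} {b} {b'} (e , f) (e' , f') →
                ⨾-cong {p = α a} {α a'} {α b} {α b'} e e' , ⨾-cong {p = β a} {β a'} {β b} {β b'} f f' }
          ; assoc = λ _ _ _ → (λ _ → refl) , (λ _ → refl) }
        ; identity = (λ _ → (λ _ → refl) , (λ _ → refl)) , (λ _ → (λ _ → refl) , (λ _ → refl)) }
      ; inverse = (λ a → to-from (α a) , to-from (β a)) , (λ a → from-to (α a) , from-to (β a))
      ; ⁻¹-cong = λ {a} {b} (e , f) → inv-cong {p = α a} {α b} e , inv-cong {p = β a} {β b} f } }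

  swapᵗ : TFAut Γ → TFAut Γ
  swapᵗ a = tf (β a) (α a) (tf-swap {α a} {β a} (isTF a))

  act : Bool → TFAut Γ → TFAut Γ
  act b a = if b then swapᵗ a else a

  _·ˢ_ : TFAut Γ × Bool → TFAut Γ × Bool → TFAut Γ × Bool
  (t₁ , a) ·ˢ (t₂ , b) = (t₁ ·ᵗ act a t₂) , (a xor b)

  _⁻¹ˢ : TFAut Γ × Bool → TFAut Γ × Bool
  (t , b) ⁻¹ˢ = act b (t ⁻¹ᵗ) , b

  _≈ˢ_ : TFAut Γ × Bool → TFAut Γ × Bool → Set
  (t , a) ≈ˢ (u , b) = (t ≈ᵗ u) × (a ≡ b)

  private
    act-cong : ∀ b {t u} → t ≈ᵗ u → act b t ≈ᵗ act b u
    act-cong false e = e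
    act-cong true (e , f) = f , e

    sd-cong : ∀ {x x' y y'} → x ≈ˢ x' → y ≈ˢ y' → (x ·ˢ y) ≈ˢ (x' ·ˢ y')
    sd-cong {t , a} {t' , .a} {u , b} {u' , .b} ((e , f) , refl) (eu , refl) =
      (⨾-cong {p = α t} {α t'} {α (act a u)} {α (act a u')} e (proj₁ (act-cong a eu)) ,
       ⨾-cong {p = β t} {β t'} {β (act a u)} {β (act a u')} f (proj₂ (act-cong a eu))) , refl

    sd-assoc : ∀ x y z → ((x ·ˢ y) ·ˢ z) ≈ˢ (x ·ˢ (y ·ˢ z))
    sd-assoc (t , false) (u , false) (v , c) = ((λ _ → refl) , (λ _ → refl)) , refl
    sd-assoc (t , false) (u , true)  (v , c) = ((λ _ → refl) , (λ _ → refl)) , refl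
    sd-assoc (t , true)  (u , false) (v , c) = ((λ _ → refl) , (λ _ → refl)) , refl
    sd-assoc (t , true)  (u , true)  (v , false) = ((λ _ → refl) , (λ _ → refl)) , refl
    sd-assoc (t , true)  (u , true)  (v , true)  = ((λ _ → refl) , (λ _ → refl)) , refl

    sd-idˡ : ∀ x → ((εᵗ , false) ·ˢ x) ≈ˢ x
    sd-idˡ (t , b) = ((λ _ → refl) , (λ _ → refl)) , refl

    sd-idʳ : ∀ x → (x ·ˢ (εᵗ , false)) ≈ˢ x
    sd-idʳ (t , false) = ((λ _ → refl) , (λ _ → refl)) , refl
    sd-idʳ (t , true)  = ((λ _ → refl) , (λ _ → refl)) , refl

    sd-invˡ : ∀ x → ((x ⁻¹ˢ) ·ˢ x) ≈ˢ (εᵗ , false)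
    sd-invˡ (t , false) = (to-from (α t) , to-from (β t)) , refl
    sd-invˡ (t , true)  = (to-from (β t) , to-from (α t)) , refl

    sd-invʳ : ∀ x → (x ·ˢ (x ⁻¹ˢ)) ≈ˢ (εᵗ , false)
    sd-invʳ (t , false) = (from-to (α t) , from-to (β t)) , refl
    sd-invʳ (t , true)  = (from-to (α t) , from-to (β t)) , refl

    sd-inv-cong : ∀ {x y} → x ≈ˢ y → (x ⁻¹ˢ) ≈ˢ (y ⁻¹ˢ)
    sd-inv-cong {t , b} {u , .b} ((e , f) , refl) =
      act-cong b {t ⁻¹ᵗ} {u ⁻¹ᵗ} (inv-cong {p = α t} {α u} e , inv-cong {p = β t} {β u} f) , refl

  TFA⋊Z₂ : Group _ _
  TFA⋊Z₂ = record
    { Carrier = TFAut Γ × Bool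
    ; _≈_ = _≈ˢ_
    ; _∙_ = _·ˢ_
    ; ε = εᵗ , false
    ; _⁻¹ = _⁻¹ˢ
    ; isGroup = record
      { isMonoid = record
        { isSemigroup = record
          { isMagma = record
            { isEquivalence = record
              { refl = ((λ _ → refl) , (λ _ → refl)) , refl
              ; sym = λ ((e , f) , g) → ((λ x → sym (e x)) , (λ x → sym (f x))) , sym g
              ; trans = λ ((e , f) , g) ((e' , f') , g') →
                  ((λ x → trans (e x) (e' x)) , (λ x → trans (f x) (f' x))) , trans g g' }
            ; ∙-cong = λ {x} {x'} {y} {y'} → sd-cong {x} {x'} {y} {y'} }
          ; assoc = sd-assoc }
        ; identity = sd-idˡ , sd-idʳ }
      ; inverse = sd-invˡ , sd-invʳ
      ; ⁻¹-cong = λ {x} {y} → sd-inv-cong {x} {y} } }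

_HasOrder_ : Group _ _ → ℕ → Set
G HasOrder k = Bijection (≡.setoid (Fin k)) (Group.setoid G)

-- Aut(Γ × K₂) = Aut(Γ) × Aut(K₂): every automorphism of Γ × K₂ acts
-- componentwise as (v , i) ↦ (v^α , i^β) with α ∈ Aut(Γ), β ∈ Aut(K₂).
-- (The reverse inclusion always holds.)
Stable : ∀ {V} → Graph V → Set
Stable Γ = ∀ (s : Automorphism (Γ ×ᴳ K₂)) →
  ∃[ a ] ∃[ b ] (∀ (x : _) → to (σ s) x ≡ (to (σ {Γ = Γ} a) (proj₁ x) , to (σ {Γ = K₂} b) (proj₂ x)))

Unstable : ∀ {V} → Graph V → Set
Unstable Γ = ¬ Stable Γ

Diagonal : ∀ {V} {Γ : Graph V} → TFAut Γ → Set
Diagonal t = ∀ s → to (α t) s ≡ to (β t) s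

SwapsParts : ∀ {V} → Graph V → (V → Bool) → Set
SwapsParts Γ side = ∃[ a ] (∀ v → side (to (σ {Γ = Γ} a) v) ≡ not (side v))

-- A point of Γ × K₂ is a pair (v , i) whose Boolean i we call its layer. An automorphism that
-- shifts every layer by the same b has the form (v , i) ↦ (v^{α_i} , i + b) for a unique
-- TF-automorphism (α₀ , α₁), and these automorphisms form a copy of TFA(Γ) ⋊ Z₂. As Γ is
-- connected and bipartite, Γ × K₂ is the disjoint union of the two copies of Γ given by
-- side v + i = c, and every automorphism φ shifts layers by an amount depending only on the
-- component. On the component c, φ induces an automorphism of Γ that swaps U and W unless
-- the shift there equals c plus the index of the image component; as φ permutes the two
-- components, in the absence of a swapping automorphism the two shifts coincide, which is (b).
-- If s swaps U and W, then (v , i) ↦ (v^s , i + 1) flips the layers of a single component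
-- and preserves it, so every automorphism is a unique product of such flips with a layer
-- preserving automorphism, and |Aut(Γ × K₂)| = 4 |TFA(Γ)|. In case (b) all automorphisms
-- are componentwise as soon as all TF-automorphisms are diagonal; since Γ is finite, the
-- existence of a non-diagonal one is decidable, so instability yields one constructively.

module Submission where

open import Defs
open import Data.Nat using (ℕ; _*_)
open import Data.Fin using (Fin)
open import Data.Bool using (Bool)
open import Data.Product using (Σ; ∃-syntax; _×_)
open import Relation.Nullary using (¬_)
open import Relation.Binary.PropositionalEquality using (_≡_)
open import Function.Bundles using (_⇔_)
open import Algebra.Bundles using (Group)
open import Algebra.Morphism.Structures using (module GroupMorphisms)

open import Data.Bool using (true; false; not; _xor_; _∧_; T)
open import Data.Bool.Properties
  using ( ∧-identityʳ; ∧-zeroʳ; xor-assoc; xor-comm; xor-identityʳ; xor-inverseˡ; xor-inverseʳ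
        ; xor-annihilates-not; ¬-not; not-involutive; T-∧ )
  renaming (_≟_ to _≟ᵇ_)
open import Data.Empty using (⊥-elim)
open import Data.Fin using (_≟_)
open import Data.Fin.Properties using (any?; all?; *↔×; 2↔Bool; cantor-schröder-bernstein)
open import Data.Nat using (zero; suc)
open import Data.Product using (_,_; proj₁; proj₂; ∃)
open import Data.Product.Function.NonDependent.Setoid using (_×-bijection_)
open import Data.Product.Relation.Binary.Pointwise.NonDependent using (_×ₛ_; Pointwise-≡↔≡; ≡×≡⇒≡; ≡⇒≡×≡)
open import Data.Unit using (tt)
open import Data.Vec using (Vec; []; _∷_; lookup; tabulate)
open import Data.Vec.Properties using (lookup∘tabulate)
open import Function.Base using (_∘_)
open import Function.Bundles using (Equivalence; Bijection; Injection; mk⇔)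
import Function.Construct.Composition as Composition
import Function.Construct.Symmetry as Symmetry
import Function.Properties.Bijection as Bijection
open import Function.Properties.Inverse using (Inverse⇒Bijection; Inverse⇒Injection)
open import Relation.Binary.Bundles using (Setoid)
open import Relation.Binary.Definitions using (DecidableEquality)
import Relation.Binary.PropositionalEquality as ≡
open import Relation.Binary.PropositionalEquality
  using (refl; sym; trans; cong; cong₂; subst; _≢_; module ≡-Reasoning)
open import Relation.Nullary using (Dec; yes; no)
open import Relation.Nullary.Decidable using (map′; _×-dec_; ¬?; decidable-stable)

xor-cancelʳ : ∀ i b → (i xor b) xor b ≡ i
xor-cancelʳ false false = refl
xor-cancelʳ false true  = refl
xor-cancelʳ true  false = refl
xor-cancelʳ true  true  = refl

xor-cancelˡ : ∀ a j → a xor (a xor j) ≡ j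
xor-cancelˡ false j     = refl
xor-cancelˡ true  false = refl
xor-cancelˡ true  true  = refl

xor-shift : ∀ i j b → (i xor b) xor (j xor b) ≡ i xor j
xor-shift false false false = refl
xor-shift false false true  = refl
xor-shift false true  false = refl
xor-shift false true  true  = refl
xor-shift true  false false = refl
xor-shift true  false true  = refl
xor-shift true  true  false = refl
xor-shift true  true  true  = refl

xor≡false⇒≡ : ∀ a b → a xor b ≡ false → a ≡ b
xor≡false⇒≡ false false _ = refl
xor≡false⇒≡ true  true  _ = refl

T-xor⇒≡not : ∀ i j → T (i xor j) → j ≡ not i
T-xor⇒≡not false true  _ = refl
T-xor⇒≡not true  false _ = refl

¬T⇒≡false : ∀ b → ¬ T b → b ≡ false
¬T⇒≡false false _ = refl
¬T⇒≡false true  h = ⊥-elim (h tt)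

walk-invariant : ∀ {X A : Set} {G : Graph X} (Q : X → A) →
  (∀ {x y} → Arc G x y → Q x ≡ Q y) → ∀ {x y} → Walk G x y → Q x ≡ Q y
walk-invariant Q inv here       = refl
walk-invariant Q inv (step a p) = trans (inv a) (walk-invariant Q inv p)

module Patch {X L : Set} (G : Graph X) (label : X → L) (_≟_ : DecidableEquality L)
             (label-arc : ∀ {x y} → Arc G x y → label x ≡ label y)
             {χ : Perm X} (χ-isAut : IsAut G χ) (χ-label : ∀ x → label (to χ x) ≡ label x) where

  select : Bool → Perm X
  select true  = χ
  select false = idₚ

  select-isAut : ∀ b → IsAut G (select b)
  select-isAut true  = χ-isAut
  select-isAut false = tf-id G

  select-label : ∀ b x → label (to (select b) x) ≡ label x
  select-label true  = χ-label
  select-label false _ = refl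

  select-label⁻ : ∀ b x → label (from (select b) x) ≡ label x
  select-label⁻ b x = trans (sym (select-label b (from (select b) x))) (cong label (to-from (select b) x))

  patch : (L → Bool) → Perm X
  patch B = record
    { to      = λ x → to (select (B (label x))) x
    ; from    = λ x → from (select (B (label x))) x
    ; to-from = λ x → trans (cong (λ l → to (select (B l)) (from (select (B (label x))) x))
                                  (select-label⁻ (B (label x)) x))
                            (to-from (select (B (label x))) x)
    ; from-to = λ x → trans (cong (λ l → from (select (B l)) (to (select (B (label x))) x))
                                  (select-label (B (label x)) x))
                            (from-to (select (B (label x))) x)
    }

  patch-label : ∀ B x → label (to (patch B) x) ≡ label x
  patch-label B x = select-label (B (label x)) x

  no-arc : ∀ {x y} → label x ≢ label y → adj G x y ≡ false
  no-arc ne = ¬T⇒≡false _ (λ a → ne (label-arc a))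

  patch-isAut : ∀ B → IsAut G (patch B)
  patch-isAut B x y with label x ≟ label y
  ... | yes e = trans (select-isAut (B (label x)) x y)
                      (cong (λ l → adj G (to (select (B (label x))) x) (to (select (B l)) y)) e)
  ... | no ne = trans (no-arc ne)
                      (sym (no-arc λ e → ne (trans (sym (patch-label B x)) (trans e (patch-label B y)))))

-- Counting and enumeration

order-unique : ∀ {c ℓ} {S : Setoid c ℓ} {k m} →
  Bijection (≡.setoid (Fin k)) S → Bijection (≡.setoid (Fin m)) S → k ≡ m
order-unique {S = S} f g =
  cantor-schröder-bernstein (Injection.injective (embedding f g)) (Injection.injective (embedding g f))
  where
  embedding : ∀ {k m} → Bijection (≡.setoid (Fin k)) S → Bijection (≡.setoid (Fin m)) S →
              Injection (≡.setoid (Fin k)) (≡.setoid (Fin m))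
  embedding f g = Inverse⇒Injection
    (Composition.inverse (Bijection.Bijection⇒Inverse f) (Symmetry.inverse (Bijection.Bijection⇒Inverse g)))

×-order : ∀ {c ℓ c′ ℓ′} {S : Setoid c ℓ} {T : Setoid c′ ℓ′} {k m} →
  Bijection (≡.setoid (Fin k)) S → Bijection (≡.setoid (Fin m)) T → Bijection (≡.setoid (Fin (k * m))) (S ×ₛ T)
×-order f g = Bijection.trans (Inverse⇒Bijection *↔×)
                (Bijection.trans (Inverse⇒Bijection (Symmetry.inverse Pointwise-≡↔≡)) (f ×-bijection g))

∃-Vec? : ∀ {n} m {P : Vec (Fin n) m → Set} → (∀ v → Dec (P v)) → Dec (∃[ v ] P v)
∃-Vec? zero    P? = map′ ([] ,_) (λ { ([] , p) → p }) (P? [])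
∃-Vec? (suc m) P? = map′ (λ (x , v , p) → x ∷ v , p) (λ { (x ∷ v , p) → x , v , p })
                         (any? λ x → ∃-Vec? m λ v → P? (x ∷ v))

module _ {n : ℕ} where

  Inverses : Vec (Fin n) n → Vec (Fin n) n → Set
  Inverses f g = (∀ i → lookup f (lookup g i) ≡ i) × (∀ i → lookup g (lookup f i) ≡ i)

  inverses? : ∀ f g → Dec (Inverses f g)
  inverses? f g = all? (λ i → lookup f (lookup g i) ≟ i) ×-dec all? (λ i → lookup g (lookup f i) ≟ i)

  vecPerm : ∀ f g → Inverses f g → Perm (Fin n)
  vecPerm f g (fg , gf) = record { to = lookup f ; from = lookup g ; to-from = fg ; from-to = gf }

  tabulate-inverse : ∀ (p : Perm (Fin n)) i → lookup (tabulate (to p)) (lookup (tabulate (from p)) i) ≡ i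
  tabulate-inverse p i =
    trans (lookup∘tabulate (to p) _) (trans (cong (to p) (lookup∘tabulate (from p) i)) (to-from p i))

  -- A permutation is enumerated as the pair of vectors tabulating it and its inverse,
  -- which recovers it only up to ≈ₚ.
  ∃-Perm? : {P : Perm (Fin n) → Set} → (∀ {p q} → p ≈ₚ q → P p → P q) → (∀ p → Dec (P p)) → Dec (∃ P)
  ∃-Perm? {P} resp P? =
    map′ (λ (f , g , inv , Pp) → vecPerm f g inv , Pp) tabulated (∃-Vec? n λ f → ∃-Vec? n λ g → candidate? f g)
    where
    candidate? : ∀ f g → Dec (Σ (Inverses f g) (P ∘ vecPerm f g))
    candidate? f g with inverses? f g
    ... | no ¬inv = no (¬inv ∘ proj₁)
    ... | yes inv = map′ (inv ,_) (λ (_ , Pp) → resp (λ _ → refl) Pp) (P? (vecPerm f g inv))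
    tabulated : ∃ P → ∃[ f ] ∃[ g ] Σ (Inverses f g) (P ∘ vecPerm f g)
    tabulated (p , Pp) = tabulate (to p) , tabulate (from p) , (tabulate-inverse p , tabulate-inverse (invₚ p)) ,
                         resp (λ i → sym (lookup∘tabulate (to p) i)) Pp

module _ {n : ℕ} (Γ : Graph (Fin n)) where

  private
    Agree : Perm (Fin n) → Perm (Fin n) → Set
    Agree a b = ∀ s → to a s ≡ to b s

    agree? : ∀ a b → Dec (Agree a b)
    agree? a b = all? λ s → to a s ≟ to b s

    isTF? : ∀ a b → Dec (IsTF Γ a b)
    isTF? a b = all? λ s → all? λ u → adj Γ s u ≟ᵇ adj Γ (to a s) (to b u)

    NonDiagonalPair : Perm (Fin n) → Perm (Fin n) → Set
    NonDiagonalPair a b = IsTF Γ a b × ¬ Agree a b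

    respˡ : ∀ {a a'} → a ≈ₚ a' → ∃ (NonDiagonalPair a) → ∃ (NonDiagonalPair a')
    respˡ e (b , isTF , nd) = b , (λ s u → trans (isTF s u) (cong (λ x → adj Γ x (to b u)) (e s))) ,
                              λ agree → nd λ s → trans (e s) (agree s)

    respʳ : ∀ a {b b'} → b ≈ₚ b' → NonDiagonalPair a b → NonDiagonalPair a b'
    respʳ a e (isTF , nd) = (λ s u → trans (isTF s u) (cong (adj Γ (to a s)) (e u))) ,
                            λ agree → nd λ s → trans (agree s) (sym (e s))

  nonDiagonal? : Dec (∃[ t ] ¬ Diagonal {Γ = Γ} t)
  nonDiagonal? = map′ (λ (a , b , isTF , nd) → tf a b isTF , nd) (λ (t , nd) → α t , β t , isTF t , nd)
    (∃-Perm? {P = ∃ ∘ NonDiagonalPair} (λ {a} {a'} → respˡ {a} {a'}) λ a →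
     ∃-Perm? {P = NonDiagonalPair a} (λ {b} {b'} → respʳ a {b} {b'}) λ b → isTF? a b ×-dec ¬? (agree? a b))

  unstable⇒nonDiagonal : ((∀ t → Diagonal {Γ = Γ} t) → Stable Γ) → Unstable Γ → ∃[ t ] ¬ Diagonal {Γ = Γ} t
  unstable⇒nonDiagonal stable unstable = decidable-stable nonDiagonal? λ none →
    unstable (stable λ t → decidable-stable (agree? (α t) (β t)) λ nd → none (t , nd))

-- Automorphisms of Γ × K₂ with a uniform layer shift

module Twist {V : Set} (Γ : Graph V) where

  layer : V × Bool → Bool
  layer = proj₂

  layerPerm : TFAut Γ → Bool → Perm V
  layerPerm t false = α t
  layerPerm t true  = β t

  layerPerm-cong : ∀ {t t'} → _≈ᵗ_ Γ t t' → ∀ i → layerPerm t i ≈ₚ layerPerm t' i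
  layerPerm-cong (eα , eβ) false = eα
  layerPerm-cong (eα , eβ) true  = eβ

  layerPerm-adj : ∀ t i j s u →
    adj Γ s u ∧ (i xor j) ≡ adj Γ (to (layerPerm t i) s) (to (layerPerm t j) u) ∧ (i xor j)
  layerPerm-adj t false false s u = trans (∧-zeroʳ _) (sym (∧-zeroʳ _))
  layerPerm-adj t true  true  s u = trans (∧-zeroʳ _) (sym (∧-zeroʳ _))
  layerPerm-adj t false true  s u = cong (_∧ true) (isTF t s u)
  layerPerm-adj t true  false s u = cong (_∧ true) (tf-swap Γ {α t} {β t} (isTF t) s u)

  act-layerPerm : ∀ b t i → layerPerm (act Γ b t) i ≈ₚ layerPerm t (i xor b)
  act-layerPerm false t false _ = refl
  act-layerPerm false t true  _ = refl
  act-layerPerm true  t false _ = refl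
  act-layerPerm true  t true  _ = refl

  twist : TFAut Γ → Bool → Perm (V × Bool)
  twist t b = record
    { to      = λ (v , i) → to (layerPerm t i) v , i xor b
    ; from    = λ (w , j) → from (layerPerm t (j xor b)) w , j xor b
    ; to-from = λ (w , j) → cong₂ _,_ (to-from (layerPerm t (j xor b)) w) (xor-cancelʳ j b)
    ; from-to = λ (v , i) → from-to′ v i
    }
    where
    from-to′ : ∀ v i → (from (layerPerm t ((i xor b) xor b)) (to (layerPerm t i) v) , (i xor b) xor b) ≡ (v , i)
    from-to′ v i rewrite xor-cancelʳ i b = cong (_, i) (from-to (layerPerm t i) v)

  twist-isAut : ∀ t b → IsAut (Γ ×ᴳ K₂) (twist t b)
  twist-isAut t b (v , i) (w , j) =
    trans (layerPerm-adj t i j v w)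
          (cong (adj Γ (to (layerPerm t i) v) (to (layerPerm t j) w) ∧_) (sym (xor-shift i j b)))

  twistAut : TFAut Γ → Bool → Automorphism (Γ ×ᴳ K₂)
  twistAut t b = aut (twist t b) (twist-isAut t b)

  twist-cong : ∀ {t t'} → _≈ᵗ_ Γ t t' → ∀ b → twist t b ≈ₚ twist t' b
  twist-cong e b (v , i) = cong (_, i xor b) (layerPerm-cong e i v)

  nonDiagonal⇒unstable : (∃[ t ] ¬ Diagonal {Γ = Γ} t) → Unstable Γ
  nonDiagonal⇒unstable (t , nondiagonal) stable with stable (twistAut t false)
  ... | _ , _ , componentwise =
    nondiagonal λ s → trans (cong proj₁ (componentwise (s , false))) (sym (cong proj₁ (componentwise (s , true))))

  record ShiftsLayersBy (ψ : Perm (V × Bool)) (b : Bool) : Set where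
    constructor shifting
    field shifts : ∀ x → layer (to ψ x) ≡ layer x xor b
  open ShiftsLayersBy public

  module Untwist {ψ : Perm (V × Bool)} {b : Bool} (sh : ShiftsLayersBy ψ b) where

    shape : ∀ x → to ψ x ≡ (proj₁ (to ψ x) , layer x xor b)
    shape x = cong (proj₁ (to ψ x) ,_) (shifts sh x)

    inverse-shifts : ShiftsLayersBy (invₚ ψ) b
    inverse-shifts = shifting λ y → begin
      layer (from ψ y)                  ≡⟨ sym (xor-cancelʳ _ b) ⟩
      (layer (from ψ y) xor b) xor b    ≡⟨ cong (_xor b) (sym (shifts sh (from ψ y))) ⟩
      layer (to ψ (from ψ y)) xor b     ≡⟨ cong (λ z → layer z xor b) (to-from ψ y) ⟩
      layer y xor b                     ∎
      where open ≡-Reasoning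

    fibre-point : ∀ i w → (proj₁ (from ψ (w , i xor b)) , i) ≡ from ψ (w , i xor b)
    fibre-point i w = cong (proj₁ (from ψ (w , i xor b)) ,_)
                           (trans (sym (xor-cancelʳ i b)) (sym (shifts inverse-shifts (w , i xor b))))

    fibre : Bool → Perm V
    fibre i = record
      { to      = λ v → proj₁ (to ψ (v , i))
      ; from    = λ w → proj₁ (from ψ (w , i xor b))
      ; to-from = λ w → cong proj₁ (trans (cong (to ψ) (fibre-point i w)) (to-from ψ _))
      ; from-to = λ v → cong proj₁ (trans (cong (from ψ) (sym (shape (v , i)))) (from-to ψ (v , i)))
      }

    untwist : IsAut (Γ ×ᴳ K₂) ψ → TFAut Γ
    untwist isA = tf (fibre false) (fibre true) λ s u → begin
      adj Γ s u                                           ≡⟨ sym (∧-identityʳ _) ⟩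
      adj (Γ ×ᴳ K₂) (s , false) (u , true)                ≡⟨ isA (s , false) (u , true) ⟩
      adj (Γ ×ᴳ K₂) (to ψ (s , false)) (to ψ (u , true))  ≡⟨ cong₂ (adj (Γ ×ᴳ K₂)) (shape _) (shape _) ⟩
      adj Γ (α′ s) (β′ u) ∧ (b xor not b)                 ≡⟨ cong (adj Γ (α′ s) (β′ u) ∧_) (xor-inverseʳ b) ⟩
      adj Γ (α′ s) (β′ u) ∧ true                          ≡⟨ ∧-identityʳ _ ⟩
      adj Γ (α′ s) (β′ u)                                 ∎
      where
      open ≡-Reasoning
      α′ β′ : V → V
      α′ = to (fibre false)
      β′ = to (fibre true)

    twist-untwist : ∀ isA → ψ ≈ₚ twist (untwist isA) b
    twist-untwist isA (v , false) = shape (v , false)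
    twist-untwist isA (v , true)  = shape (v , true)

  untwist-layerPerm : ∀ {ψ b} (sh : ShiftsLayersBy ψ b) isA i v →
    to (layerPerm (Untwist.untwist sh isA) i) v ≡ proj₁ (to ψ (v , i))
  untwist-layerPerm sh isA false v = refl
  untwist-layerPerm sh isA true  v = refl

  act-untwist-inverse : ∀ {ψ} b (sh : ShiftsLayersBy ψ b) isA i v →
    proj₁ (from ψ (v , i)) ≡ to (layerPerm (act Γ b (_⁻¹ᵗ Γ (Untwist.untwist sh isA))) i) v
  act-untwist-inverse false sh isA false v = refl
  act-untwist-inverse false sh isA true  v = refl
  act-untwist-inverse true  sh isA false v = refl
  act-untwist-inverse true  sh isA true  v = refl

module UniformShifts {V : Set} (Γ : Graph V) (v₀ : V) where
  open Twist Γ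
  open GroupMorphisms (Group.rawGroup (AutGroup (Γ ×ᴳ K₂))) (Group.rawGroup (TFA⋊Z₂ Γ))
  open Group (AutGroup (Γ ×ᴳ K₂)) using (_∙_; _⁻¹)

  shift : Automorphism (Γ ×ᴳ K₂) → Bool
  shift φ = layer (to (σ φ) (v₀ , false))

  xorPerm : Bool → Perm Bool
  xorPerm b = record { to = _xor b ; from = _xor b ; to-from = λ i → xor-cancelʳ i b ; from-to = λ i → xor-cancelʳ i b }

  module _ (uniform : ∀ φ → ShiftsLayersBy (σ φ) (shift φ)) where

    untwistAut : Automorphism (Γ ×ᴳ K₂) → TFAut Γ
    untwistAut φ = Untwist.untwist (uniform φ) (isAut φ)

    decompose : Automorphism (Γ ×ᴳ K₂) → TFAut Γ × Bool
    decompose φ = untwistAut φ , shift φ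

    decompose-cong : ∀ {φ φ'} → σ φ ≈ₚ σ φ' → _≈ˢ_ Γ (decompose φ) (decompose φ')
    decompose-cong e = ((λ v → cong proj₁ (e (v , false))) , (λ v → cong proj₁ (e (v , true)))) ,
                       cong layer (e (v₀ , false))

    decompose-homo : ∀ φ ψ → _≈ˢ_ Γ (decompose (φ ∙ ψ)) (_·ˢ_ Γ (decompose φ) (decompose ψ))
    decompose-homo φ ψ = (layer-homo false , layer-homo true) , shifts (uniform ψ) (to (σ φ) (v₀ , false))
      where
      layer-homo : ∀ i v → proj₁ (to (σ ψ) (to (σ φ) (v , i)))
                         ≡ to (layerPerm (act Γ (shift φ) (untwistAut ψ)) i) (proj₁ (to (σ φ) (v , i)))
      layer-homo i v = begin
        proj₁ (to (σ ψ) (to (σ φ) (v , i)))                  ≡⟨ cong (proj₁ ∘ to (σ ψ)) (Untwist.shape (uniform φ) (v , i)) ⟩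
        proj₁ (to (σ ψ) (w , i xor shift φ))                 ≡⟨ sym (untwist-layerPerm (uniform ψ) (isAut ψ) (i xor shift φ) w) ⟩
        to (layerPerm (untwistAut ψ) (i xor shift φ)) w      ≡⟨ sym (act-layerPerm (shift φ) (untwistAut ψ) i w) ⟩
        to (layerPerm (act Γ (shift φ) (untwistAut ψ)) i) w  ∎
        where
        open ≡-Reasoning
        w = proj₁ (to (σ φ) (v , i))

    decompose-inverse : ∀ φ → _≈ˢ_ Γ (decompose (φ ⁻¹)) (_⁻¹ˢ Γ (decompose φ))
    decompose-inverse φ = ( act-untwist-inverse (shift φ) (uniform φ) (isAut φ) false
                          , act-untwist-inverse (shift φ) (uniform φ) (isAut φ) true )
                        , shifts (Untwist.inverse-shifts (uniform φ)) (v₀ , false)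

    decompose-injective : ∀ {φ φ'} → _≈ˢ_ Γ (decompose φ) (decompose φ') → σ φ ≈ₚ σ φ'
    decompose-injective {φ} {φ'} (et , eb) x = begin
      to (σ φ) x                               ≡⟨ Untwist.twist-untwist (uniform φ) (isAut φ) x ⟩
      to (twist (untwistAut φ) (shift φ)) x    ≡⟨ twist-cong et (shift φ) x ⟩
      to (twist (untwistAut φ') (shift φ)) x   ≡⟨ cong (λ b → to (twist (untwistAut φ') b) x) eb ⟩
      to (twist (untwistAut φ') (shift φ')) x  ≡⟨ sym (Untwist.twist-untwist (uniform φ') (isAut φ') x) ⟩
      to (σ φ') x                              ∎
      where open ≡-Reasoning

    decompose-surjective : ∀ y → ∃[ φ ] (∀ {z} → σ z ≈ₚ σ φ → _≈ˢ_ Γ (decompose z) y)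
    decompose-surjective (t , b) = twistAut t b , λ {z} → decompose-cong {z} {twistAut t b}

    decompose-isGroupIsomorphism : IsGroupIsomorphism decompose
    decompose-isGroupIsomorphism = record
      { isGroupMonomorphism = record
        { isGroupHomomorphism = record
          { isMonoidHomomorphism = record
            { isMagmaHomomorphism = record
              { isRelHomomorphism = record { cong = λ {φ} {φ'} → decompose-cong {φ} {φ'} }
              ; homo = decompose-homo }
            ; ε-homo = ((λ _ → refl) , (λ _ → refl)) , refl }
          ; ⁻¹-homo = decompose-inverse }
        ; injective = λ {φ} {φ'} → decompose-injective {φ} {φ'} }
      ; surjective = decompose-surjective }

    allDiagonal⇒stable : (∀ t → Diagonal {Γ = Γ} t) → Stable Γ
    allDiagonal⇒stable diagonal φ = aut (α t) α-isAut , aut (xorPerm (shift φ)) xor-isAut , componentwise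
      where
      t = untwistAut φ
      α-isAut : IsAut Γ (α t)
      α-isAut u w = trans (isTF t u w) (cong (adj Γ (to (α t) u)) (sym (diagonal t w)))
      xor-isAut : IsAut K₂ (xorPerm (shift φ))
      xor-isAut i j = sym (xor-shift i j (shift φ))
      componentwise : ∀ x → to (σ φ) x ≡ (to (α t) (proj₁ x) , proj₂ x xor shift φ)
      componentwise (v , false) = Untwist.twist-untwist (uniform φ) (isAut φ) (v , false)
      componentwise (v , true)  = trans (Untwist.twist-untwist (uniform φ) (isAut φ) (v , true))
                                        (cong (_, true xor shift φ) (sym (diagonal t v)))

-- Connected bipartite graphs

module ConnectedBipartite {V : Set} (Γ : Graph V) (side : V → Bool)
                          (conn : Connected Γ) (bip : IsBipartition Γ side) where
  open Twist Γ
  open Group (AutGroup (Γ ×ᴳ K₂)) using (_∙_; _⁻¹)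

  v₀ : V
  v₀ = proj₁ conn

  -- Γ × K₂ has the two components component x ≡ c, each a copy of Γ via inComponent c.
  component : V × Bool → Bool
  component (v , i) = side v xor i

  inComponent : Bool → V → V × Bool
  inComponent c v = v , side v xor c

  component-inComponent : ∀ c v → component (inComponent c v) ≡ c
  component-inComponent c v = xor-cancelˡ (side v) c

  inComponent-component : ∀ x → inComponent (component x) (proj₁ x) ≡ x
  inComponent-component (v , i) = cong (v ,_) (xor-cancelˡ (side v) i)

  ≡inComponent : ∀ {x c} → component x ≡ c → x ≡ inComponent c (proj₁ x)
  ≡inComponent {x} e = trans (sym (inComponent-component x)) (cong (λ d → inComponent d (proj₁ x)) e)

  bipartite-adj : ∀ u w → adj Γ u w ∧ (side u xor side w) ≡ adj Γ u w
  bipartite-adj u w with adj Γ u w in e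
  ... | false = refl
  ... | true  = trans (cong (_xor side w) (¬-not (bip u w (subst T (sym e) tt)))) (xor-inverseˡ (side w))

  inComponent-adj : ∀ c u w → adj (Γ ×ᴳ K₂) (inComponent c u) (inComponent c w) ≡ adj Γ u w
  inComponent-adj c u w = trans (cong (adj Γ u w ∧_) (xor-shift (side u) (side w) c)) (bipartite-adj u w)

  arc-flips-layer : ∀ {x y} → Arc (Γ ×ᴳ K₂) x y → layer y ≡ not (layer x)
  arc-flips-layer {u , i} {w , j} a = T-xor⇒≡not i j (proj₂ (Equivalence.to T-∧ a))

  arc-component : ∀ {x y} → Arc (Γ ×ᴳ K₂) x y → component x ≡ component y
  arc-component {u , i} {w , j} a = begin
    side u xor i            ≡⟨ sym (xor-annihilates-not (side u) i) ⟩
    not (side u) xor not i  ≡⟨ cong₂ _xor_ (sym (¬-not (λ e → bip u w arcΓ (sym e)))) (sym (arc-flips-layer a)) ⟩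
    side w xor j            ∎
    where
    open ≡-Reasoning
    arcΓ : Arc Γ u w
    arcΓ = proj₁ (Equivalence.to T-∧ a)

  liftWalk : ∀ {u w} → Walk Γ u w → ∀ c → Walk (Γ ×ᴳ K₂) (inComponent c u) (inComponent c w)
  liftWalk here                c = here
  liftWalk (step {u} {m} a p) c = step (subst T (sym (inComponent-adj c u m)) a) (liftWalk p c)

  walkFromBase : ∀ x → Walk (Γ ×ᴳ K₂) (inComponent (component x) v₀) x
  walkFromBase x = subst (Walk (Γ ×ᴳ K₂) _) (inComponent-component x) (liftWalk (proj₂ conn v₀ (proj₁ x)) (component x))

  component-invariant : ∀ {A : Set} (Q : V × Bool → A) → (∀ {x y} → Arc (Γ ×ᴳ K₂) x y → Q x ≡ Q y) →
    ∀ x → Q x ≡ Q (inComponent (component x) v₀)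
  component-invariant Q inv x = sym (walk-invariant Q inv (walkFromBase x))

  module AutomorphismOf (φ : Automorphism (Γ ×ᴳ K₂)) where

    private
      ψ = σ φ

    arc-preserved : ∀ {x y} → Arc (Γ ×ᴳ K₂) x y → Arc (Γ ×ᴳ K₂) (to ψ x) (to ψ y)
    arc-preserved {x} {y} = subst T (isAut φ x y)

    layerShift : V × Bool → Bool
    layerShift x = layer (to ψ x) xor layer x

    layerShift-arc : ∀ {x y} → Arc (Γ ×ᴳ K₂) x y → layerShift x ≡ layerShift y
    layerShift-arc {x} {y} a = sym (begin
      layer (to ψ y) xor layer y              ≡⟨ cong₂ _xor_ (arc-flips-layer {to ψ x} (arc-preserved a))
                                                             (arc-flips-layer {x} a) ⟩
      not (layer (to ψ x)) xor not (layer x)  ≡⟨ xor-annihilates-not (layer (to ψ x)) (layer x) ⟩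
      layer (to ψ x) xor layer x              ∎)
      where open ≡-Reasoning

    componentMap : Bool → Bool
    componentMap c = component (to ψ (inComponent c v₀))

    shiftMap : Bool → Bool
    shiftMap c = layerShift (inComponent c v₀)

    component-to : ∀ x → component (to ψ x) ≡ componentMap (component x)
    component-to = component-invariant (component ∘ to ψ) (arc-component ∘ arc-preserved)

    layer-to : ∀ x → layer (to ψ x) ≡ layer x xor shiftMap (component x)
    layer-to x = begin
      layer (to ψ x)                            ≡⟨ sym (xor-cancelˡ (layer x) _) ⟩
      layer x xor (layer x xor layer (to ψ x))  ≡⟨ cong (layer x xor_) (xor-comm (layer x) _) ⟩
      layer x xor layerShift x                  ≡⟨ cong (layer x xor_) (component-invariant layerShift layerShift-arc x) ⟩
      layer x xor shiftMap (component x)        ∎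
      where open ≡-Reasoning

  shiftMap-cong : ∀ {φ φ'} → σ φ ≈ₚ σ φ' → ∀ c → AutomorphismOf.shiftMap φ c ≡ AutomorphismOf.shiftMap φ' c
  shiftMap-cong e c = cong (λ y → layer y xor layer (inComponent c v₀)) (e (inComponent c v₀))

  componentMap-injective : ∀ φ {c d} → AutomorphismOf.componentMap φ c ≡ AutomorphismOf.componentMap φ d → c ≡ d
  componentMap-injective φ {c} {d} e = trans (sym (left-inverse c)) (trans (cong (componentMap (φ ⁻¹)) e) (left-inverse d))
    where
    open AutomorphismOf using (componentMap)
    left-inverse : ∀ c → componentMap (φ ⁻¹) (componentMap φ c) ≡ c
    left-inverse c = begin
      componentMap (φ ⁻¹) (componentMap φ c)                ≡⟨ sym (AutomorphismOf.component-to (φ ⁻¹) (to (σ φ) x)) ⟩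
      component (from (σ φ) (to (σ φ) x))                   ≡⟨ cong component (from-to (σ φ) x) ⟩
      component x                                           ≡⟨ component-inComponent c v₀ ⟩
      c                                                     ∎
      where
      open ≡-Reasoning
      x = inComponent c v₀

  module Restriction (φ : Automorphism (Γ ×ᴳ K₂)) (c : Bool) where
    open AutomorphismOf φ

    private
      ψ = σ φ

    image : Bool
    image = componentMap c

    restrictTo : V → V
    restrictTo v = proj₁ (to ψ (inComponent c v))

    restrictFrom : V → V
    restrictFrom w = proj₁ (from ψ (inComponent image w))

    to-inComponent : ∀ v → to ψ (inComponent c v) ≡ inComponent image (restrictTo v)
    to-inComponent v = ≡inComponent (trans (component-to _) (cong componentMap (component-inComponent c v)))

    from-inComponent : ∀ w → from ψ (inComponent image w) ≡ inComponent c (restrictFrom w)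
    from-inComponent w = ≡inComponent (componentMap-injective φ (begin
      componentMap (component (from ψ (inComponent image w)))  ≡⟨ sym (component-to _) ⟩
      component (to ψ (from ψ (inComponent image w)))          ≡⟨ cong component (to-from ψ _) ⟩
      component (inComponent image w)                           ≡⟨ component-inComponent image w ⟩
      image                                                     ∎))
      where open ≡-Reasoning

    restrict : Perm V
    restrict = record
      { to      = restrictTo
      ; from    = restrictFrom
      ; to-from = λ w → cong proj₁ (trans (cong (to ψ) (sym (from-inComponent w))) (to-from ψ _))
      ; from-to = λ v → cong proj₁ (trans (cong (from ψ) (sym (to-inComponent v))) (from-to ψ _))
      }

    restrict-isAut : IsAut Γ restrict
    restrict-isAut u w = begin
      adj Γ u w                                                         ≡⟨ sym (inComponent-adj c u w) ⟩
      adj (Γ ×ᴳ K₂) (inComponent c u) (inComponent c w)                 ≡⟨ isAut φ _ _ ⟩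
      adj (Γ ×ᴳ K₂) (to ψ (inComponent c u)) (to ψ (inComponent c w))   ≡⟨ cong₂ (adj (Γ ×ᴳ K₂)) (to-inComponent u)
                                                                                                  (to-inComponent w) ⟩
      adj (Γ ×ᴳ K₂) (inComponent image (restrictTo u)) (inComponent image (restrictTo w))
                                                                        ≡⟨ inComponent-adj image _ _ ⟩
      adj Γ (restrictTo u) (restrictTo w)                               ∎
      where open ≡-Reasoning

    sideShift : Bool
    sideShift = (c xor shiftMap c) xor image

    restrict-side : ∀ v → side (restrictTo v) ≡ sideShift xor side v
    restrict-side v = begin
      side (restrictTo v)                                ≡⟨ sym (xor-cancelʳ _ image) ⟩
      layer (inComponent image (restrictTo v)) xor image ≡⟨ cong (λ x → layer x xor image) (sym (to-inComponent v)) ⟩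
      layer (to ψ (inComponent c v)) xor image           ≡⟨ cong (_xor image) (layer-to (inComponent c v)) ⟩
      ((side v xor c) xor shiftMap (component (inComponent c v))) xor image
                                                         ≡⟨ cong (λ d → ((side v xor c) xor shiftMap d) xor image)
                                                                 (component-inComponent c v) ⟩
      ((side v xor c) xor shiftMap c) xor image          ≡⟨ cong (_xor image) (xor-assoc (side v) c (shiftMap c)) ⟩
      (side v xor (c xor shiftMap c)) xor image          ≡⟨ xor-assoc (side v) _ image ⟩
      side v xor sideShift                               ≡⟨ xor-comm (side v) sideShift ⟩
      sideShift xor side v                               ∎
      where open ≡-Reasoning

    swapsParts : sideShift ≡ true → SwapsParts Γ side
    swapsParts e = aut restrict restrict-isAut , λ v → trans (restrict-side v) (cong (_xor side v) e)

  module NoSwap (noSwap : ¬ SwapsParts Γ side) (φ : Automorphism (Γ ×ᴳ K₂)) where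
    open AutomorphismOf φ

    -- Both restrictions preserve the parts, so componentMap c ≡ c + shiftMap c; the two
    -- shifts then agree because componentMap is injective.
    shiftMap-constant : ∀ c → shiftMap c ≡ shiftMap false
    shiftMap-constant false = refl
    shiftMap-constant true  = sym (trans (¬-not shiftMaps-not-opposite) (not-involutive (shiftMap true)))
      where
      preserves-sides : ∀ c → Restriction.sideShift φ c ≡ false
      preserves-sides c = ¬-not (λ e → noSwap (Restriction.swapsParts φ c e))
      images-agree : shiftMap false ≡ not (shiftMap true) → componentMap false ≡ componentMap true
      images-agree e = begin
        componentMap false   ≡⟨ sym (xor≡false⇒≡ _ _ (preserves-sides false)) ⟩
        shiftMap false       ≡⟨ e ⟩
        not (shiftMap true)  ≡⟨ xor≡false⇒≡ _ _ (preserves-sides true) ⟩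
        componentMap true    ∎
        where open ≡-Reasoning
      shiftMaps-not-opposite : shiftMap false ≢ not (shiftMap true)
      shiftMaps-not-opposite e with componentMap-injective φ {false} {true} (images-agree e)
      ... | ()

    uniform : ShiftsLayersBy (σ φ) (UniformShifts.shift Γ v₀ φ)
    uniform = shifting λ x → begin
      layer (to (σ φ) x)                             ≡⟨ layer-to x ⟩
      layer x xor shiftMap (component x)             ≡⟨ cong (layer x xor_) (trans (shiftMap-constant _)
                                                          (sym (shiftMap-constant (component (v₀ , false))))) ⟩
      layer x xor shiftMap (component (v₀ , false))  ≡⟨ cong (layer x xor_) (sym (layer-to (v₀ , false))) ⟩
      layer x xor UniformShifts.shift Γ v₀ φ         ∎
      where open ≡-Reasoning

  module WithSwap (swap : SwapsParts Γ side) where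
    open AutomorphismOf using (shiftMap)

    s₀ : TFAut Γ
    s₀ = tf (σ (proj₁ swap)) (σ (proj₁ swap)) (isAut (proj₁ swap))

    flip : Perm (V × Bool)
    flip = twist s₀ true

    flip-point : ∀ v i → to flip (v , i) ≡ (to (σ (proj₁ swap)) v , not i)
    flip-point v false = refl
    flip-point v true  = refl

    flip-component : ∀ x → component (to flip x) ≡ component x
    flip-component (v , i) = begin
      component (to flip (v , i))             ≡⟨ cong component (flip-point v i) ⟩
      side (to (σ (proj₁ swap)) v) xor not i  ≡⟨ cong (_xor not i) (proj₂ swap v) ⟩
      not (side v) xor not i                  ≡⟨ xor-annihilates-not (side v) i ⟩
      side v xor i                            ∎
      where open ≡-Reasoning

    open Patch (Γ ×ᴳ K₂) component _≟ᵇ_ arc-component {flip} (twist-isAut s₀ true) flip-component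

    select-shifts : ∀ b → ShiftsLayersBy (select b) b
    select-shifts true  = shifting λ _ → refl
    select-shifts false = shifting λ x → sym (xor-identityʳ (layer x))

    flipsOn : Bool × Bool → Bool → Bool
    flipsOn p false = proj₁ p
    flipsOn p true  = proj₂ p

    flipper : Bool × Bool → Automorphism (Γ ×ᴳ K₂)
    flipper p = aut (patch (flipsOn p)) (patch-isAut (flipsOn p))

    flipper-shifts : ∀ p x → layer (to (σ (flipper p)) x) ≡ layer x xor flipsOn p (component x)
    flipper-shifts p x = shifts (select-shifts (flipsOn p (component x))) x

    flipper-unshifts : ∀ p x → layer (from (σ (flipper p)) x) ≡ layer x xor flipsOn p (component x)
    flipper-unshifts p x = shifts (Untwist.inverse-shifts (select-shifts (flipsOn p (component x)))) x

    glue : (Bool × Bool) × TFAut Γ → Automorphism (Γ ×ᴳ K₂)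
    glue (p , t) = flipper p ⁻¹ ∙ twistAut t false

    glue-flipper : ∀ p t x → to (σ (glue (p , t))) (to (σ (flipper p)) x) ≡ to (twist t false) x
    glue-flipper p t x = cong (to (twist t false)) (from-to (σ (flipper p)) x)

    glue-cong : ∀ {p p' t t'} → p ≡ p' → _≈ᵗ_ Γ t t' → σ (glue (p , t)) ≈ₚ σ (glue (p' , t'))
    glue-cong {p} refl e x = twist-cong e false (from (σ (flipper p)) x)

    shiftMap-glue : ∀ p t c → shiftMap (glue (p , t)) c ≡ flipsOn p c
    shiftMap-glue p t c = begin
      (layer y xor false) xor layer x                    ≡⟨ cong (_xor layer x) (xor-identityʳ (layer y)) ⟩
      layer y xor layer x                                ≡⟨ cong (_xor layer x) (flipper-unshifts p x) ⟩
      (layer x xor flipsOn p (component x)) xor layer x  ≡⟨ xor-comm _ (layer x) ⟩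
      layer x xor (layer x xor flipsOn p (component x))  ≡⟨ xor-cancelˡ (layer x) _ ⟩
      flipsOn p (component x)                            ≡⟨ cong (flipsOn p) (component-inComponent c v₀) ⟩
      flipsOn p c                                        ∎
      where
      open ≡-Reasoning
      x = inComponent c v₀
      y = from (σ (flipper p)) x

    glue-injective : ∀ {p p' t t'} → σ (glue (p , t)) ≈ₚ σ (glue (p' , t')) → p ≡ p' × _≈ᵗ_ Γ t t'
    glue-injective {p} {p'} {t} {t'} e = p≡p' , (layers-equal false , layers-equal true)
      where
      open ≡-Reasoning
      pattern-equal : ∀ c → flipsOn p c ≡ flipsOn p' c
      pattern-equal c = trans (sym (shiftMap-glue p t c))
                              (trans (shiftMap-cong {glue (p , t)} {glue (p' , t')} e c) (shiftMap-glue p' t' c))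
      p≡p' : p ≡ p'
      p≡p' = cong₂ _,_ (pattern-equal false) (pattern-equal true)
      layers-equal : ∀ i v → to (layerPerm t i) v ≡ to (layerPerm t' i) v
      layers-equal i v = begin
        proj₁ (to (twist t false) (v , i))                            ≡⟨ cong proj₁ (sym (glue-flipper p t (v , i))) ⟩
        proj₁ (to (σ (glue (p , t))) (to (σ (flipper p)) (v , i)))    ≡⟨ cong proj₁ (e _) ⟩
        proj₁ (to (σ (glue (p' , t'))) (to (σ (flipper p)) (v , i)))  ≡⟨ cong (λ q → proj₁ (to (σ (glue (p' , t')))
                                                                                 (to (σ (flipper q)) (v , i)))) p≡p' ⟩
        proj₁ (to (σ (glue (p' , t'))) (to (σ (flipper p')) (v , i))) ≡⟨ cong proj₁ (glue-flipper p' t' (v , i)) ⟩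
        proj₁ (to (twist t' false) (v , i))                           ∎

    module Decomposition (φ : Automorphism (Γ ×ᴳ K₂)) where
      open AutomorphismOf φ using (layer-to)

      flipPattern : Bool × Bool
      flipPattern = shiftMap φ false , shiftMap φ true

      flipsOn-flipPattern : ∀ c → flipsOn flipPattern c ≡ shiftMap φ c
      flipsOn-flipPattern false = refl
      flipsOn-flipPattern true  = refl

      unflipped : Automorphism (Γ ×ᴳ K₂)
      unflipped = flipper flipPattern ∙ φ

      unflipped-preserves : ShiftsLayersBy (σ unflipped) false
      unflipped-preserves = shifting λ x → begin
        layer (to (σ φ) (to κ x))                           ≡⟨ layer-to (to κ x) ⟩
        layer (to κ x) xor shiftMap φ (component (to κ x))  ≡⟨ cong₂ _xor_ (flipper-shifts flipPattern x)
                                                                 (cong (shiftMap φ) (patch-label (flipsOn flipPattern) x)) ⟩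
        (layer x xor flipsOn flipPattern (component x)) xor shiftMap φ (component x)
                                                            ≡⟨ cong (λ b → (layer x xor b) xor shiftMap φ (component x))
                                                                    (flipsOn-flipPattern (component x)) ⟩
        (layer x xor shiftMap φ (component x)) xor shiftMap φ (component x)
                                                            ≡⟨ xor-cancelʳ (layer x) _ ⟩
        layer x                                             ≡⟨ sym (xor-identityʳ (layer x)) ⟩
        layer x xor false                                   ∎
        where
        open ≡-Reasoning
        κ = σ (flipper flipPattern)

      tfPart : TFAut Γ
      tfPart = Untwist.untwist unflipped-preserves (isAut unflipped)

      glue-decomposition : σ (glue (flipPattern , tfPart)) ≈ₚ σ φ
      glue-decomposition x = begin
        to (twist tfPart false) (from κ x)  ≡⟨ sym (Untwist.twist-untwist unflipped-preserves (isAut unflipped) (from κ x)) ⟩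
        to (σ φ) (to κ (from κ x))          ≡⟨ cong (to (σ φ)) (to-from κ x) ⟩
        to (σ φ) x                          ∎
        where
        open ≡-Reasoning
        κ = σ (flipper flipPattern)

    glue-bijection : Bijection ((≡.setoid Bool ×ₛ ≡.setoid Bool) ×ₛ Group.setoid (TFAGroup Γ))
                               (Group.setoid (AutGroup (Γ ×ᴳ K₂)))
    glue-bijection = record
      { to        = glue
      ; cong      = λ (ep , et) → glue-cong (≡×≡⇒≡ ep) et
      ; bijective = (λ {x} {y} e → let (p≡p' , t≈t') = glue-injective {proj₁ x} {proj₁ y} {proj₂ x} {proj₂ y} e
                                   in ≡⇒≡×≡ p≡p' , t≈t')
                  , λ φ → let open Decomposition φ in
                      (flipPattern , tfPart) , λ (ep , et) x → trans (glue-cong (≡×≡⇒≡ ep) et x) (glue-decomposition x)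
      }

    aut-order : ∀ {k l} → AutGroup (Γ ×ᴳ K₂) HasOrder k → TFAGroup Γ HasOrder l → k ≡ 4 * l
    aut-order ordAut ordTFA = order-unique ordAut (Bijection.trans (×-order (×-order bool bool) ordTFA) glue-bijection)
      where
      bool : Bijection (≡.setoid (Fin 2)) (≡.setoid Bool)
      bool = Inverse⇒Bijection 2↔Bool

lemma3p3 : ∀ {n : ℕ} (Γ : Graph (Fin n)) (side : Fin n → Bool) →
    Connected Γ → IsBipartition Γ side →
    (SwapsParts Γ side →
      ∀ (k l : ℕ) → AutGroup (Γ ×ᴳ K₂) HasOrder k → TFAGroup Γ HasOrder l → k ≡ 4 * l)
    ×
    (¬ SwapsParts Γ side →
      (∃[ f ] GroupMorphisms.IsGroupIsomorphism (Group.rawGroup (AutGroup (Γ ×ᴳ K₂))) (Group.rawGroup (TFA⋊Z₂ Γ)) f)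
      × (Unstable Γ ⇔ (∃[ t ] (¬ Diagonal {Γ = Γ} t))))
lemma3p3 Γ side conn bip =
    (λ swap _ _ → WithSwap.aut-order swap)
  , λ noSwap → let open UniformShifts Γ v₀ in
      (decompose (NoSwap.uniform noSwap) , decompose-isGroupIsomorphism (NoSwap.uniform noSwap))
    , mk⇔ (unstable⇒nonDiagonal Γ (allDiagonal⇒stable (NoSwap.uniform noSwap))) (Twist.nonDiagonal⇒unstable Γ)
  where open ConnectedBipartite Γ side conn bip
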